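{- Let $C=[P_C,T_C,F_C,W_C,\chi,\gamma,m_{0C}]$ be a (uniform) coloured Petri net, $U$ its unfolding and $S$ its skeleton, and let $\mu$ be the net morphism from $U$ to $S$ given by $\mu([p,c])=p$ and $\mu([t,g])=t$. Extend $\mu$ to markings by $\mu(m_U)(p)=\sum_{c\in\chi(p)} m_U([p,c])$ for every $p\in P_C$, and let $\sigma$ be the function on markings (reachable or not) with $\sigma(m_U)=\mu(m_U)$. Then $\sigma$ is a surjective abstraction function from the markings of $U$ to the markings of $S$, i.e. for every marking $m_S$ of $S$ and every atomic proposition $a_S$ over the places of $S$ (with unfolding $a_U$): $m_S\models a_S$ if and only if every marking $m_U$ of $U$ with $\sigma(m_U)=m_S$ satisfies $m_U\models a_U$. Hence an abstraction relation exists between the markings of $U$ and $S$.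
   Context: A coloured Petri net $C=[P_C,T_C,F_C,W_C,\chi,\gamma,m_{0C}]$ has finite disjoint sets of places $P_C$ and transitions $T_C$, arcs $F_C\subseteq (P_C\times T_C)\cup(T_C\times P_C)$, a weight function $W_C$ assigning a finite set of variables to each arc ($W_C(x,y)=\emptyset$ if $(x,y)\notin F_C$), a colouring function $\chi$ assigning a finite set of colours $\chi(p)$ to each place, a guard $\gamma(t)$ (a Boolean predicate over the variables on arcs adjacent to $t$) for each transition, and an initial marking $m_{0C}$ assigning to each place $p$ a multiset over $\chi(p)$; $m(p)(c)$ is the number of tokens of colour $c$ on $p$. A firing mode $g$ of $t$ assigns to each variable on an arc between $t$ and a place $p$ a colour of $\chi(p)$; $g\models\gamma(t)$ means $g$ satisfies the guard. The unfolding $U$ is the place/transition net with places $[p,c]$ ($p\in P_C$, $c\in\chi(p)$), transitions $[t,g]$ ($g\models\gamma(t)$), arc weights $W_U([p,c],[t,g])=|\{x\in W_C(p,t): g(x)=c\}|$, $W_U([t,g],[p,c])=|\{x\in W_C(t,p):g(x)=c\}|$ (arc present iff weight positive), and initial marking $m_{0U}([p,c])=m_{0C}(p)(c)$. The skeleton $S$ is the place/transition net with places $P_C$, transitions $T_C$, arcs $F_C$, weights $W_S(x,y)=|W_C(x,y)|$ and initial marking $m_{0S}(p)=\sum_{c\in\chi(p)}m_{0C}(p)(c)$. An atomic proposition over a set of places is an expression $k_1p_1+\dots+k_np_n\le k$ with integers $k_i,k$; a marking $m$ of a place/transition net satisfies it iff $\sum_i k_i m(p_i)\le k$. The unfolding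 $a_U$ of an atomic proposition $a_S$ over places of $C$ (equivalently of $S$) is obtained by replacing each place $p$ by $\sum_{c\in\chi(p)}[p,c]$. An abstraction function from a set of states $Q$ to $\hat Q$ is a surjective map $\sigma:Q\to\hat Q$ such that for every $\hat q\in\hat Q$ and atomic proposition $a$: $\hat q\models a$ iff every $q$ with $\sigma(q)=\hat q$ satisfies $q\models a$. -}

module Defs where

open import Data.Nat using (ℕ; suc)
open import Data.Bool using (Bool)
open import Data.Fin using (Fin)
open import Data.List using (List; []; _∷_; map; allFin; foldr)
open import Data.Integer using (ℤ; +_; _+_; _*_; _≤_)
open import Data.Product using (Σ; _,_)

-- The colour set χ(p) of place p is Fin (suc (χ-1 p)), i.e. a finite,
-- NON-EMPTY set of colours.
-- Arc weights are finite sets (lists) of variables; an empty list means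
-- the arc is absent from F_C.
record CPN : Set₁ where
  field
    nP   : ℕ
    nT   : ℕ
    χ-1  : Fin nP → ℕ
    Var  : Set
    Win  : Fin nP → Fin nT → List Var
    Wout : Fin nT → Fin nP → List Var
  Place : Set
  Place = Fin nP
  Colour : Place → Set
  Colour p = Fin (suc (χ-1 p))
  Mode : Set
  Mode = (p : Place) → Var → Colour p
  field
    γ    : Fin nT → Mode → Bool
    m0   : (p : Place) → Colour p → ℕ

open CPN public

sumℤ : List ℤ → ℤ
sumℤ = foldr _+_ (+ 0)

sumℕ : List ℕ → ℕ
sumℕ = foldr Data.Nat._+_ 0

PlaceU : CPN → Set
PlaceU C = Σ (Place C) (Colour C)

MarkingU : CPN → Set
MarkingU C = PlaceU C → ℕ

MarkingS : CPN → Set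
MarkingS C = Place C → ℕ

σ : (C : CPN) → MarkingU C → MarkingS C
σ C mU p = sumℕ (map (λ c → mU (p , c)) (allFin (suc (χ-1 C p))))

-- Atomic proposition Σ_i k_i p_i ≤ k over the places of S
-- (coefficient k_p of each place; absent places have coefficient 0).
record AtomS (C : CPN) : Set where
  constructor atomS
  field
    coeff : Place C → ℤ
    bound : ℤ

record AtomU (C : CPN) : Set where
  constructor atomU
  field
    coeff : PlaceU C → ℤ
    bound : ℤ

_⊨S_ : {C : CPN} → MarkingS C → AtomS C → Set
_⊨S_ {C} m a =
  sumℤ (map (λ p → AtomS.coeff a p * + m p) (allFin (nP C))) ≤ AtomS.bound a

_⊨U_ : {C : CPN} → MarkingU C → AtomU C → Set
_⊨U_ {C} m a =
  sumℤ (map (λ p → sumℤ (map (λ c → AtomU.coeff a (p , c) * + m (p , c))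
                               (allFin (suc (χ-1 C p)))))
            (allFin (nP C)))
  ≤ AtomU.bound a

-- Unfolding of an atomic proposition: replace p by Σ_{c ∈ χ(p)} [p,c],
-- i.e. every [p,c] gets the coefficient of p.
unfoldAtom : {C : CPN} → AtomS C → AtomU C
unfoldAtom a = atomU (λ pc → AtomS.coeff a (Data.Product.proj₁ pc)) (AtomS.bound a)

{-# OPTIONS --safe #-}
module Submission where

-- The unfolded proposition weighs every place [p,c] by the coefficient of p, so by
-- distributivity its left-hand side at m_U equals that of a_S at σ(m_U): satisfaction
-- is transported exactly along σ. Surjectivity of σ is witnessed by putting all
-- tokens of p on the first colour of χ(p), which exists since colour sets are non-empty.

open import Defs
open import Data.Product using (_×_; Σ; _,_)
open import Function.Bundles using (_⇔_; mk⇔; Equivalence)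
open import Relation.Binary.PropositionalEquality
  using (_≡_; refl; sym; cong; subst; module ≡-Reasoning)
open import Data.Nat as ℕ using (ℕ)
open import Data.Nat.Properties using (+-identityʳ)
open import Data.Fin using (Fin; zero; suc)
open import Data.List using (List; []; _∷_; map; tabulate; allFin)
open import Data.List.Properties using (map-cong)
open import Data.Integer using (ℤ; +_; _+_; _*_; _≤_)
open import Data.Integer.Properties using (pos-+; *-distribˡ-+; *-zeroʳ)

sumℕ-map-tabulate-zero : ∀ {A : Set} {n} (g : Fin n → A) (f : A → ℕ) →
  (∀ i → f (g i) ≡ 0) → sumℕ (map f (tabulate g)) ≡ 0
sumℕ-map-tabulate-zero {n = ℕ.zero} g f f∘g≡0 = refl
sumℕ-map-tabulate-zero {n = ℕ.suc n} g f f∘g≡0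
  rewrite f∘g≡0 zero = sumℕ-map-tabulate-zero (λ i → g (suc i)) f (λ i → f∘g≡0 (suc i))

sumℤ-map-*ˡ : ∀ {A : Set} (k : ℤ) (f : A → ℕ) (xs : List A) →
  sumℤ (map (λ x → k * + f x) xs) ≡ k * + sumℕ (map f xs)
sumℤ-map-*ˡ k f [] = sym (*-zeroʳ k)
sumℤ-map-*ˡ k f (x ∷ xs) = begin
  k * + f x + sumℤ (map (λ y → k * + f y) xs) ≡⟨ cong (_+_ (k * + f x)) (sumℤ-map-*ˡ k f xs) ⟩
  k * + f x + k * + s                         ≡⟨ sym (*-distribˡ-+ k (+ f x) (+ s)) ⟩
  k * (+ f x + + s)                           ≡⟨ cong (k *_) (sym (pos-+ (f x) s)) ⟩
  k * + (f x ℕ.+ s)                           ∎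
  where
  open ≡-Reasoning
  s : ℕ
  s = sumℕ (map f xs)

module _ {C : CPN} where

  weightedSumS : AtomS C → MarkingS C → ℤ
  weightedSumS a m = sumℤ (map (λ p → AtomS.coeff a p * + m p) (allFin (nP C)))

  weightedSumS-cong : (a : AtomS C) {m m′ : MarkingS C} →
    (∀ p → m p ≡ m′ p) → weightedSumS a m ≡ weightedSumS a m′
  weightedSumS-cong a m≗m′ =
    cong sumℤ (map-cong (λ p → cong (λ x → AtomS.coeff a p * + x) (m≗m′ p)) (allFin (nP C)))

  ⊨S-cong : (a : AtomS C) {m m′ : MarkingS C} → (∀ p → m p ≡ m′ p) → m ⊨S a → m′ ⊨S a
  ⊨S-cong a m≗m′ = subst (_≤ AtomS.bound a) (weightedSumS-cong a m≗m′)

  weightedSumU : AtomU C → MarkingU C → ℤ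
  weightedSumU a m = sumℤ (map (λ p → sumℤ (map (λ c → AtomU.coeff a (p , c) * + m (p , c))
                                                (allFin (ℕ.suc (χ-1 C p)))))
                               (allFin (nP C)))

  weightedSumU-unfoldAtom : (a : AtomS C) (mU : MarkingU C) →
    weightedSumU (unfoldAtom a) mU ≡ weightedSumS a (σ C mU)
  weightedSumU-unfoldAtom a mU =
    cong sumℤ (map-cong (λ p → sumℤ-map-*ˡ (AtomS.coeff a p) (λ c → mU (p , c)) (allFin (ℕ.suc (χ-1 C p))))
                        (allFin (nP C)))

  ⊨U-unfoldAtom⇔⊨S-σ : (a : AtomS C) (mU : MarkingU C) → (mU ⊨U unfoldAtom a) ⇔ (σ C mU ⊨S a)
  ⊨U-unfoldAtom⇔⊨S-σ a mU = mk⇔ (subst (_≤ AtomS.bound a) sums≡) (subst (_≤ AtomS.bound a) (sym sums≡))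
    where
    sums≡ : weightedSumU (unfoldAtom a) mU ≡ weightedSumS a (σ C mU)
    sums≡ = weightedSumU-unfoldAtom a mU

  concentrate : MarkingS C → MarkingU C
  concentrate mS (p , zero)  = mS p
  concentrate mS (p , suc _) = 0

  σ-concentrate : (mS : MarkingS C) → ∀ p → σ C (concentrate mS) p ≡ mS p
  σ-concentrate mS p = begin
    mS p ℕ.+ sumℕ (map (λ c → concentrate mS (p , c)) (tabulate {n = χ-1 C p} suc))
      ≡⟨ cong (mS p ℕ.+_) (sumℕ-map-tabulate-zero suc (λ c → concentrate mS (p , c)) (λ _ → refl)) ⟩
    mS p ℕ.+ 0
      ≡⟨ +-identityʳ (mS p) ⟩
    mS p ∎
    where open ≡-Reasoning

theorem1 : (C : CPN) →
    ((mS : MarkingS C) → Σ (MarkingU C) (λ mU → ∀ p → σ C mU p ≡ mS p))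
    × ((mS : MarkingS C) (aS : AtomS C) →
         (mS ⊨S aS) ⇔ ((mU : MarkingU C) → (∀ p → σ C mU p ≡ mS p) → mU ⊨U unfoldAtom aS))
theorem1 C = surjective , abstraction
  where
  surjective : (mS : MarkingS C) → Σ (MarkingU C) (λ mU → ∀ p → σ C mU p ≡ mS p)
  surjective mS = concentrate {C} mS , σ-concentrate {C} mS

  abstraction : (mS : MarkingS C) (aS : AtomS C) →
    (mS ⊨S aS) ⇔ ((mU : MarkingU C) → (∀ p → σ C mU p ≡ mS p) → mU ⊨U unfoldAtom aS)
  abstraction mS aS = mk⇔
    (λ mS⊨aS mU σmU≗mS →
       from (⊨U-unfoldAtom⇔⊨S-σ aS mU) (⊨S-cong aS (λ p → sym (σmU≗mS p)) mS⊨aS))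
    (λ fibre⊨ →
       ⊨S-cong aS (σ-concentrate {C} mS)
         (to (⊨U-unfoldAtom⇔⊨S-σ aS mU₀) (fibre⊨ mU₀ (σ-concentrate {C} mS))))
    where
    open Equivalence
    mU₀ : MarkingU C
    mU₀ = concentrate {C} mS
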